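{- Let $G$ and $H$ be connected graphs of orders $n_1\ge2$ and $n_2\ge2$ respectively, and let $k\ge1$ be an integer (with $G\odot^0H:=G$). Then $Z(G\odot^{k}H)=Z(G\odot^{k-1}H)+n_1(n_2+1)^{k-1}$ if and only if $H\cong P_{n_2}$.
   Context: Zero forcing: given a set $S$ of initially black vertices (others white), the color-change rule turns a white vertex black if it is the only white neighbor of some black vertex; $S$ is a zero forcing set if eventually all vertices become black; $Z(G)$ is the minimum size of a zero forcing set. Corona: for $G$ of order $n_1$, $G\odot H$ is obtained from $G$ and $n_1$ disjoint copies of $H$ by joining the $i$-th vertex of $G$ to every vertex of the $i$-th copy; $G\odot^1H=G\odot H$, $G\odot^kH=(G\odot^{k-1}H)\odot H$. $P_{n_2}$ is the path on $n_2$ vertices. -}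

module Defs where

open import Data.Nat using (ℕ; zero; suc; _+_; _*_; _≡ᵇ_; _≤_)
open import Data.Bool using (Bool; true; false; _∧_; _∨_)
open import Data.Fin using (Fin; toℕ; splitAt; quotRem)
open import Data.Fin.Properties using (_≟_)
open import Data.Fin.Subset using (Subset; _∈_; ∣_∣)
open import Data.Sum using (_⊎_; inj₁; inj₂)
open import Data.Product using (Σ; _×_; _,_; proj₁; proj₂)
open import Relation.Nullary.Decidable using (⌊_⌋)
open import Relation.Binary.PropositionalEquality using (_≡_; _≢_)
open import Function.Bundles using (_↔_; Inverse)

record Graph (n : ℕ) : Set where
  constructor mkGraph
  field
    adj : Fin n → Fin n → Bool
open Graph public

IsSimple : ∀ {n} → Graph n → Set
IsSimple {n} G = (∀ (u v : Fin n) → adj G u v ≡ adj G v u) × (∀ (u : Fin n) → adj G u u ≡ false)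

data Reach {n : ℕ} (G : Graph n) : Fin n → Fin n → Set where
  here : ∀ {u} → Reach G u u
  step : ∀ {u v w} → adj G u v ≡ true → Reach G v w → Reach G u w

Connected : ∀ {n} → Graph n → Set
Connected {n} G = ∀ (u v : Fin n) → Reach G u v

Path : (n : ℕ) → Graph n
Path n = mkGraph (λ i j → (toℕ i ≡ᵇ suc (toℕ j)) ∨ (toℕ j ≡ᵇ suc (toℕ i)))

_≅_ : ∀ {n m} → Graph n → Graph m → Set
_≅_ {n} {m} G H = Σ (Fin n ↔ Fin m) λ f →
  ∀ (u v : Fin n) → adj G u v ≡ adj H (Inverse.to f u) (Inverse.to f v)

-- Corona G ⊙ H.  Vertices of G ⊙ H are Fin (n1 + n1 * n2): the first n1 are
-- the vertices of G, a vertex p of the second block with quotRem n2 p = (h , c)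
-- is vertex h of the c-th copy of H.
coronaAdj : ∀ {n1 n2} → Graph n1 → Graph n2 →
            Fin n1 ⊎ Fin (n1 * n2) → Fin n1 ⊎ Fin (n1 * n2) → Bool
coronaAdj G H (inj₁ i) (inj₁ j) = adj G i j
coronaAdj {n1} {n2} G H (inj₁ i) (inj₂ p) = ⌊ proj₂ (quotRem {n1} n2 p) ≟ i ⌋
coronaAdj {n1} {n2} G H (inj₂ p) (inj₁ i) = ⌊ proj₂ (quotRem {n1} n2 p) ≟ i ⌋
coronaAdj {n1} {n2} G H (inj₂ p) (inj₂ q) =
  ⌊ proj₂ (quotRem {n1} n2 p) ≟ proj₂ (quotRem {n1} n2 q) ⌋
  ∧ adj H (proj₁ (quotRem {n1} n2 p)) (proj₁ (quotRem {n1} n2 q))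

corona : ∀ {n1 n2} → Graph n1 → Graph n2 → Graph (n1 + n1 * n2)
corona {n1} {n2} G H = mkGraph (λ u v → coronaAdj G H (splitAt n1 u) (splitAt n1 v))

iterOrder : ℕ → ℕ → ℕ → ℕ
iterOrder n1 n2 zero = n1
iterOrder n1 n2 (suc k) = iterOrder n1 n2 k + iterOrder n1 n2 k * n2

iterCorona : ∀ {n1 n2} → Graph n1 → Graph n2 → (k : ℕ) → Graph (iterOrder n1 n2 k)
iterCorona G H zero = G
iterCorona G H (suc k) = corona (iterCorona G H k) H

data Black {n : ℕ} (G : Graph n) (S : Subset n) : Fin n → Set where
  initial : ∀ {v} → v ∈ S → Black G S v
  force   : ∀ (u w : Fin n) → Black G S u → adj G u w ≡ true →
            (∀ (x : Fin n) → adj G u x ≡ true → x ≢ w → Black G S x) →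
            Black G S w

IsZeroForcingSet : ∀ {n} → Graph n → Subset n → Set
IsZeroForcingSet {n} G S = ∀ (v : Fin n) → Black G S v

IsZeroForcingNumber : ∀ {n} → Graph n → ℕ → Set
IsZeroForcingNumber {n} G m =
  (Σ (Subset n) λ S → IsZeroForcingSet G S × ∣ S ∣ ≡ m)
  × (∀ (S : Subset n) → IsZeroForcingSet G S → m ≤ ∣ S ∣)

module Submission where

-- Put G' = G ⊙^j H, a graph of order N = n₁(n₂+1)^j without isolated vertices.
-- Then G ⊙^(j+1) H = G' ⊙ H consists of the "centres" G' and one copy of H (the
-- "leaves" of a centre) attached to every centre.  For an arbitrary corona G' ⊙ H
-- with H free of isolated vertices we show:
--   (1) a zero forcing set T of G' ⊙ H projects to a zero forcing set S of G' with
--       |S| + N ≤ |T|, so Z(G' ⊙ H) ≥ Z(G') + N;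
--   (2) a zero forcing set of G' ⊙ H with fewer than 2N vertices meets some copy of
--       H in a single vertex t, and then {t} is a zero forcing set of H;
--   (3) zero forcing sets S of G' and B of H give one of G' ⊙ H of size |S| + N|B|.
-- About H alone we show:
--   (4) a simple graph with a one-vertex zero forcing set is a path: starting at
--       that vertex we grow a "forcing chain" until it exhausts the graph;
--   (5) a path, hence every graph isomorphic to one, has a one-vertex forcing set.
-- As Z(G') < N, (1), (2), (4) give "⇒", and (1), (3), (5) give "⇐".

open import Defs
open import Data.Nat
  using (ℕ; zero; suc; _+_; _*_; _^_; _∸_; _≤_; _<_; z≤n; s≤s; s≤s⁻¹; _≤?_; _≡ᵇ_)
import Data.Nat as ℕ
open import Data.Nat.Properties
  using ( +-0-commutativeMonoid; +-mono-≤; +-monoˡ-≤; +-monoˡ-<; +-assoc; +-identityʳ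
        ; *-identityʳ; *-comm; *-suc; *-assoc; ≤-refl; ≤-trans; ≤-antisym; ≤-reflexive
        ; <-trans; <-irrefl; <⇒≢; <-cmp; ≤-<-trans; <⇒≤; <⇒≱; n<1+n; n≤1+n; m≤n+m
        ; m≤n⇒m<n∨m≡n; suc-injective; ≡ᵇ⇒≡ )
open import Algebra.Properties.CommutativeMonoid.Sum +-0-commutativeMonoid
  using (sum; ∑-distrib-+)
open import Data.Bool using (Bool; true; false; _∧_; _∨_)
open import Data.Bool.Properties using (∨-identityʳ; ∨-zeroʳ; T-≡) renaming (_≟_ to _≟ᵇ_)
open import Data.Fin
  using (Fin; zero; suc; toℕ; fromℕ<; inject₁; _↑ˡ_; _↑ʳ_; combine; splitAt; quotRem
        ; remQuot; join; punchOut)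
open import Data.Fin.Properties
  using ( _≟_; toℕ-injective; toℕ-fromℕ<; toℕ<n; toℕ-inject₁; splitAt-↑ˡ; splitAt-↑ʳ
        ; join-splitAt; remQuot-combine; combine-remQuot; ↑ˡ-injective; ↑ʳ-injective
        ; combine-injective; any?; all?; ¬∀⟶∃¬; injective⇒≤; punchOut-injective )
open import Data.Fin.Subset using (Subset; _∈_; ∣_∣; ⁅_⁆; ∁)
open import Data.Fin.Subset.Properties
  using (x∈⁅x⁆; x∈⁅y⁆⇒x≡y; ∣⁅x⁆∣≡1; ∣∁p∣≡n∸∣p∣; x∉p⇒x∈∁p)
open import Data.Vec using (_∷_; []; lookup; tabulate)
open import Data.Vec.Properties using (lookup∘tabulate; []=⇒lookup; lookup⇒[]=)
open import Data.Product using (∃; _×_; _,_; proj₁; proj₂; swap)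
open import Data.Sum using (_⊎_; inj₁; inj₂; [_,_]′)
open import Data.Empty using (⊥-elim)
open import Relation.Nullary using (¬_; Dec; yes; no)
open import Relation.Nullary.Decidable using (⌊_⌋; toWitness; isYes≗does; dec-true; _×-dec_; _→-dec_; ¬?)
open import Relation.Binary.PropositionalEquality
  using (_≡_; _≢_; refl; sym; trans; cong; cong₂; subst; subst₂; module ≡-Reasoning)
open import Relation.Binary using (tri<; tri≈; tri>)
open import Function using (_∘_)
open import Function.Bundles using (_⇔_; mk⇔; Inverse; Equivalence; mk↔ₛ′)

indicator : Bool → ℕ
indicator true  = 1
indicator false = 0

count : ∀ {m} → (Fin m → Bool) → ℕ
count p = sum (indicator ∘ p)

sum-cong : ∀ {m} {f g : Fin m → ℕ} → (∀ i → f i ≡ g i) → sum f ≡ sum g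
sum-cong {zero}  f≡g = refl
sum-cong {suc m} f≡g = cong₂ _+_ (f≡g zero) (sum-cong (f≡g ∘ suc))

sum-mono : ∀ {m} {f g : Fin m → ℕ} → (∀ i → f i ≤ g i) → sum f ≤ sum g
sum-mono {zero}  f≤g = z≤n
sum-mono {suc m} f≤g = +-mono-≤ (f≤g zero) (sum-mono (f≤g ∘ suc))

sum-const : ∀ m c → sum {m} (λ _ → c) ≡ m * c
sum-const zero    c = refl
sum-const (suc m) c = cong (c +_) (sum-const m c)

sum-↑ : ∀ a b (f : Fin (a + b) → ℕ) →
        sum f ≡ sum (λ i → f (i ↑ˡ b)) + sum (λ j → f (a ↑ʳ j))
sum-↑ zero    b f = refl
sum-↑ (suc a) b f = trans (cong (f zero +_) (sum-↑ a b (f ∘ suc)))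
                          (sym (+-assoc (f zero) _ _))

sum-combine : ∀ a b (f : Fin (a * b) → ℕ) →
              sum f ≡ sum {a} (λ i → sum {b} (λ j → f (combine i j)))
sum-combine zero    b f = refl
sum-combine (suc a) b f = trans (sum-↑ b (a * b) f)
  (cong (sum (λ j → f (j ↑ˡ (a * b))) +_) (sum-combine a b (λ q → f (b ↑ʳ q))))

∣∣≡count : ∀ {m} (S : Subset m) → ∣ S ∣ ≡ count (lookup S)
∣∣≡count []          = refl
∣∣≡count (true ∷ S)  = cong suc (∣∣≡count S)
∣∣≡count (false ∷ S) = ∣∣≡count S

count≥1 : ∀ {m} (p : Fin m → Bool) i → p i ≡ true → 1 ≤ count p
count≥1 p zero    pi rewrite pi = s≤s z≤n
count≥1 p (suc i) pi = ≤-trans (count≥1 (p ∘ suc) i pi) (m≤n+m _ (indicator (p zero)))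

count≥2 : ∀ {m} (p : Fin m → Bool) i j → i ≢ j → p i ≡ true → p j ≡ true → 2 ≤ count p
count≥2 p zero    zero    i≢j _  _  = ⊥-elim (i≢j refl)
count≥2 p zero    (suc j) _   pi pj rewrite pi = s≤s (count≥1 (p ∘ suc) j pj)
count≥2 p (suc i) zero    _   pi pj rewrite pj = s≤s (count≥1 (p ∘ suc) i pi)
count≥2 p (suc i) (suc j) i≢j pi pj =
  ≤-trans (count≥2 (p ∘ suc) i j (i≢j ∘ cong suc) pi pj) (m≤n+m _ (indicator (p zero)))

count≥1⇒witness : ∀ {m} (p : Fin m → Bool) → 1 ≤ count p → ∃ λ i → p i ≡ true
count≥1⇒witness {suc m} p c with p zero in p0
... | true  = zero , p0
... | false with count≥1⇒witness (p ∘ suc) c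
...   | i , pi = suc i , pi

∈⇒lookup : ∀ {m} {S : Subset m} {i} → i ∈ S → lookup S i ≡ true
∈⇒lookup = []=⇒lookup

∈-tabulate : ∀ {m} (p : Fin m → Bool) {i} → p i ≡ true → i ∈ tabulate p
∈-tabulate p {i} pi = lookup⇒[]= i (tabulate p) (trans (lookup∘tabulate p i) pi)

≟-true : ∀ {m} {u v : Fin m} → ⌊ u ≟ v ⌋ ≡ true → u ≡ v
≟-true e = toWitness (Equivalence.from T-≡ e)

⌊⌋-true : ∀ {A : Set} (a? : Dec A) → A → ⌊ a? ⌋ ≡ true
⌊⌋-true a? a = trans (isYes≗does a?) (dec-true a? a)

≟-refl : ∀ {m} (u : Fin m) → ⌊ u ≟ u ⌋ ≡ true
≟-refl u = ⌊⌋-true (u ≟ u) refl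

∧-true : ∀ {a b} → a ∧ b ≡ true → a ≡ true × b ≡ true
∧-true {true} {true} _ = refl , refl

∨-true : ∀ {a b} → a ∨ b ≡ true → a ≡ true ⊎ b ≡ true
∨-true {true}  _ = inj₁ refl
∨-true {false} e = inj₂ e

≡ᵇ-true : ∀ {a b} → (a ≡ᵇ b) ≡ true → a ≡ b
≡ᵇ-true {a} {b} e = ≡ᵇ⇒≡ a b (Equivalence.from T-≡ e)

≡ᵇ-refl : ∀ a → (a ≡ᵇ a) ≡ true
≡ᵇ-refl zero    = refl
≡ᵇ-refl (suc a) = ≡ᵇ-refl a

≡ᵇ-false : ∀ {a b} → a ≢ b → (a ≡ᵇ b) ≡ false
≡ᵇ-false {a} {b} a≢b with a ≡ᵇ b in eq
... | false = refl
... | true  = ⊥-elim (a≢b (≡ᵇ-true eq))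

NoIsolatedVertex : ∀ {n} → Graph n → Set
NoIsolatedVertex {n} G = ∀ (v : Fin n) → ∃ λ u → adj G u v ≡ true × u ≢ v

walk-lastStep : ∀ {n} {G : Graph n} {w v} → Reach G w v → w ≢ v →
                ∃ λ u → adj G u v ≡ true × u ≢ v
walk-lastStep here w≢v = ⊥-elim (w≢v refl)
walk-lastStep {w = w} {v} (step {v = x} a walk) w≢v with x ≟ v
... | yes refl = w , a , w≢v
... | no x≢v   = walk-lastStep walk x≢v

connected⇒noIsolated : ∀ {n} (G : Graph n) → 2 ≤ n → Connected G → NoIsolatedVertex G
connected⇒noIsolated G (s≤s (s≤s _)) conn zero    = walk-lastStep (conn (suc zero) zero) (λ ())
connected⇒noIsolated G (s≤s (s≤s _)) conn (suc v) = walk-lastStep (conn zero (suc v)) (λ ())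

-- All vertices but one form a zero forcing set when no vertex is isolated: a neighbour
-- of the missing vertex forces it.  Hence Z(G) < |V(G)|.
noIsolated⇒Z<order : ∀ {n} (G : Graph n) → NoIsolatedVertex G → Fin n →
                     ∀ z → IsZeroForcingNumber G z → z < n
noIsolated⇒Z<order {suc m} G noIso v₀ z (_ , minimal) =
  ≤-<-trans (minimal S zfS) (subst (_< suc m) (sym ∣S∣≡m) (n<1+n m))
  where
  S : Subset (suc m)
  S = ∁ ⁅ v₀ ⁆
  others∈S : ∀ {v} → v ≢ v₀ → v ∈ S
  others∈S v≢v₀ = x∉p⇒x∈∁p (v≢v₀ ∘ x∈⁅y⁆⇒x≡y _)
  zfS : IsZeroForcingSet G S
  zfS v with v ≟ v₀
  ... | no v≢v₀ = initial (others∈S v≢v₀)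
  ... | yes refl with noIso v
  ...   | u , a , u≢v = force u v (initial (others∈S u≢v)) a (λ y _ y≢v → initial (others∈S y≢v))
  ∣S∣≡m : ∣ S ∣ ≡ m
  ∣S∣≡m = trans (∣∁p∣≡n∸∣p∣ ⁅ v₀ ⁆) (cong (suc m ∸_) (∣⁅x⁆∣≡1 v₀))

OnlyNeighbourOutside : ∀ {n} → Graph n → (Fin n → Set) → Fin n → Fin n → Set
OnlyNeighbourOutside {n} G B u w =
  adj G u w ≡ true × ¬ B w × (∀ (y : Fin n) → adj G u y ≡ true → ¬ B y → y ≡ w)

closed-under-forcing : ∀ {n} {G : Graph n} {S : Subset n} (B : Fin n → Set) →
  (∀ v → Dec (B v)) → (∀ {v} → v ∈ S → B v) →
  (∀ u w → B u → ¬ OnlyNeighbourOutside G B u w) →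
  ∀ {v} → Black G S v → B v
closed-under-forcing B B? S⊆B noExit (initial v∈S) = S⊆B v∈S
closed-under-forcing {G = G} B B? S⊆B noExit (force x w bx a others) with B? w
... | yes Bw = Bw
... | no ¬Bw = ⊥-elim (noExit x w (inB bx) (a , ¬Bw , unique))
  where
  inB : ∀ {v} → Black G _ v → B v
  inB = closed-under-forcing B B? S⊆B noExit
  unique : ∀ y → adj G x y ≡ true → ¬ B y → y ≡ w
  unique y ay ¬By with y ≟ w
  ... | yes y≡w = y≡w
  ... | no y≢w  = ⊥-elim (¬By (inB (others y ay y≢w)))

black-transport : ∀ {n m} {G : Graph n} {H : Graph m} (f : G ≅ H) {SG : Subset n} {SH : Subset m} →
  (∀ {w} → w ∈ SH → Inverse.from (proj₁ f) w ∈ SG) →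
  ∀ {w} → Black H SH w → Black G SG (Inverse.from (proj₁ f) w)
black-transport f SH↦SG (initial w∈SH) = initial (SH↦SG w∈SH)
black-transport {G = G} {H} f SH↦SG (force x w bx a others) =
  force (from x) (from w) (black-transport f SH↦SG bx) adjG othersG
  where
  open Inverse (proj₁ f) using (to; from; strictlyInverseˡ; strictlyInverseʳ)
  adj-from : ∀ x y → adj G (from x) y ≡ adj H x (to y)
  adj-from x y = trans (proj₂ f (from x) y) (cong (λ z → adj H z (to y)) (strictlyInverseˡ x))
  adjG : adj G (from x) (from w) ≡ true
  adjG = trans (adj-from x (from w)) (trans (cong (adj H x) (strictlyInverseˡ w)) a)
  othersG : ∀ y → adj G (from x) y ≡ true → y ≢ from w → Black G _ y
  othersG y ay y≢ = subst (Black G _) (strictlyInverseʳ y)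
    (black-transport f SH↦SG (others (to y) (trans (sym (adj-from x y)) ay)
                                             (λ e → y≢ (trans (sym (strictlyInverseʳ y)) (cong from e)))))

-- (5) Paths have a one-vertex zero forcing set

-- End vertex 0 forces the path: i + 1 is forced by i, whose only other neighbour
-- i - 1 is already black.
path-zeroForcing : ∀ m → IsZeroForcingSet (Path (suc m)) ⁅ zero ⁆
path-zeroForcing m i = blackUpTo (toℕ i) i ≤-refl
  where
  P = Path (suc m)
  blackUpTo : ∀ k (i : Fin (suc m)) → toℕ i ≤ k → Black P ⁅ zero ⁆ i
  blackUpTo k       zero    _         = initial (x∈⁅x⁆ zero)
  blackUpTo (suc k) (suc j) (s≤s j≤k) =
    force (inject₁ j) (suc j) (blackUpTo k (inject₁ j) (subst (_≤ k) (sym (toℕ-inject₁ j)) j≤k))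
          adjacent others
    where
    adjacent : adj P (inject₁ j) (suc j) ≡ true
    adjacent rewrite toℕ-inject₁ j | ≡ᵇ-refl (toℕ j) = ∨-zeroʳ _
    others : ∀ y → adj P (inject₁ j) y ≡ true → y ≢ suc j → Black P ⁅ zero ⁆ y
    others y a y≢ with ∨-true {toℕ (inject₁ j) ≡ᵇ suc (toℕ y)} a
    ... | inj₁ below = blackUpTo k y (≤-trans (n≤1+n (toℕ y))
                         (subst (_≤ k) (trans (sym (toℕ-inject₁ j)) (≡ᵇ-true below)) j≤k))
    ... | inj₂ above = ⊥-elim (y≢ (toℕ-injective (trans (≡ᵇ-true above) (cong suc (toℕ-inject₁ j)))))

≅path⇒singletonZF : ∀ {n} (H : Graph n) → 1 ≤ n → H ≅ Path n →
                    ∃ λ t → IsZeroForcingSet H ⁅ t ⁆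
≅path⇒singletonZF {suc m} H _ f = from zero , zf
  where
  open Inverse (proj₁ f) using (to; from; strictlyInverseʳ)
  end↦t : ∀ {w} → w ∈ ⁅ zero ⁆ → from w ∈ ⁅ from zero ⁆
  end↦t w∈ rewrite x∈⁅y⁆⇒x≡y zero w∈ = x∈⁅x⁆ (from zero)
  zf : IsZeroForcingSet H ⁅ from zero ⁆
  zf h = subst (Black H _) (strictlyInverseʳ h) (black-transport f end↦t (path-zeroForcing m (to h)))

-- (4) A simple graph with a one-vertex zero forcing set is a path

injective⇒surjective : ∀ {k} (f : Fin k → Fin k) → (∀ {a b} → f a ≡ f b → a ≡ b) →
                       ∀ y → ∃ λ i → f i ≡ y
injective⇒surjective {suc k} f f-inj y with any? (λ i → f i ≟ y)
... | yes hit = hit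
... | no miss = ⊥-elim (<-irrefl refl (injective⇒≤ {f = f′} f′-inj))
  where
  -- f misses y, so it factors injectively through Fin (suc k) ∖ {y} ≅ Fin k
  f′ : Fin (suc k) → Fin k
  f′ i = punchOut {i = y} {j = f i} (λ y≡fi → miss (i , sym y≡fi))
  f′-inj : ∀ {a b} → f′ a ≡ f′ b → a ≡ b
  f′-inj {a} {b} e = f-inj (punchOut-injective (λ y≡ → miss (a , sym y≡)) (λ y≡ → miss (b , sym y≡)) e)

module SingletonForcing {n : ℕ} (H : Graph n)
  (symH : ∀ u v → adj H u v ≡ adj H v u) (loopH : ∀ u → adj H u u ≡ false)
  (t : Fin n) (zf : IsZeroForcingSet H ⁅ t ⁆) where

  record Chain (m : ℕ) : Set where
    field
      v        : ℕ → Fin n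
      distinct : ∀ i j → i < m → j < m → v i ≡ v j → i ≡ j
      starts   : v 0 ≡ t
      adjacent : ∀ i → suc i < m → adj H (v i) (v (suc i)) ≡ true
      closed   : ∀ i → suc i < m → ∀ y → adj H (v i) y ≡ true → ∃ λ j → j ≤ suc i × v j ≡ y

  trivialChain : Chain 1
  trivialChain = record
    { v        = λ _ → t
    ; distinct = λ { zero zero _ _ _ → refl ; (suc i) _ (s≤s ()) _ _ ; zero (suc j) _ (s≤s ()) _ }
    ; starts   = refl
    ; adjacent = λ { i (s≤s ()) }
    ; closed   = λ { i (s≤s ()) }
    }

  -- The chain vertices cannot absorb all
  -- forcing (there are too few of them), so by closed-under-forcing some chain vertex
  -- has a unique neighbour w off the chain; by closedness that vertex is the last one,
  -- and appending w gives a longer chain.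
  module Extend {m : ℕ} (c : Chain m) (1≤m : 1 ≤ m) (m<n : m < n) where
    open Chain c

    OnChain : Fin n → Set
    OnChain y = ∃ λ (j : Fin m) → v (toℕ j) ≡ y

    OnChain? : ∀ y → Dec (OnChain y)
    OnChain? y = any? (λ j → v (toℕ j) ≟ y)

    onChain : ∀ j → j < m → OnChain (v j)
    onChain j j<m = fromℕ< j<m , cong v (toℕ-fromℕ< j<m)

    notAllOnChain : ¬ (∀ y → OnChain y)
    notAllOnChain all = <⇒≱ m<n (injective⇒≤ {f = position} position-inj)
      where
      position : Fin n → Fin m
      position y = proj₁ (all y)
      position-inj : ∀ {a b} → position a ≡ position b → a ≡ b
      position-inj {a} {b} e = trans (sym (proj₂ (all a))) (trans (cong (v ∘ toℕ) e) (proj₂ (all b)))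

    Exit : Set
    Exit = ∃ λ (i : Fin m) → ∃ λ w → OnlyNeighbourOutside H OnChain (v (toℕ i)) w

    Exit? : Dec Exit
    Exit? = any? λ i → any? λ w →
      (adj H (v (toℕ i)) w ≟ᵇ true) ×-dec ¬? (OnChain? w) ×-dec
      all? (λ y → (adj H (v (toℕ i)) y ≟ᵇ true) →-dec (¬? (OnChain? y) →-dec (y ≟ w)))

    exit : Exit
    exit with Exit?
    ... | yes e = e
    ... | no ¬e = ⊥-elim (notAllOnChain λ y →
                    closed-under-forcing OnChain OnChain? t-onChain noExit (zf y))
      where
      t-onChain : ∀ {y} → y ∈ ⁅ t ⁆ → OnChain y
      t-onChain y∈ = subst OnChain (trans starts (sym (x∈⁅y⁆⇒x≡y t y∈))) (onChain 0 1≤m)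
      noExit : ∀ u w → OnChain u → ¬ OnlyNeighbourOutside H OnChain u w
      noExit u w (i , refl) only = ¬e (i , w , only)

    i : Fin m
    i = proj₁ exit
    w : Fin n
    w = proj₁ (proj₂ exit)
    adj-w : adj H (v (toℕ i)) w ≡ true
    adj-w = proj₁ (proj₂ (proj₂ exit))
    w-off : ¬ OnChain w
    w-off = proj₁ (proj₂ (proj₂ (proj₂ exit)))
    w-unique : ∀ y → adj H (v (toℕ i)) y ≡ true → ¬ OnChain y → y ≡ w
    w-unique = proj₂ (proj₂ (proj₂ (proj₂ exit)))

    -- earlier chain vertices have all their neighbours on the chain
    exit-isLast : suc (toℕ i) ≡ m
    exit-isLast with m≤n⇒m<n∨m≡n (toℕ<n i)
    ... | inj₂ last = last
    ... | inj₁ notLast with closed (toℕ i) notLast w adj-w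
    ...   | j , j≤ , vj≡w = ⊥-elim (w-off (subst OnChain vj≡w (onChain j (≤-<-trans j≤ notLast))))

    v′ : ℕ → Fin n
    v′ k with k ℕ.≟ m
    ... | yes _ = w
    ... | no _  = v k

    v′-new : v′ m ≡ w
    v′-new with m ℕ.≟ m
    ... | yes _   = refl
    ... | no m≢m = ⊥-elim (m≢m refl)

    v′-old : ∀ k → k < m → v′ k ≡ v k
    v′-old k k<m with k ℕ.≟ m
    ... | yes k≡m = ⊥-elim (<-irrefl k≡m k<m)
    ... | no _    = refl

    data Position (k : ℕ) : Set where
      old : k < m → Position k
      new : k ≡ m → Position k

    position : ∀ k → k < suc m → Position k
    position k k<sm with m≤n⇒m<n∨m≡n (s≤s⁻¹ k<sm)
    ... | inj₁ k<m = old k<m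
    ... | inj₂ k≡m = new k≡m

    old≢new : ∀ a → a < m → v′ a ≢ w
    old≢new a a<m e = w-off (subst OnChain (trans (sym (v′-old a a<m)) e) (onChain a a<m))

    distinct′ : ∀ a b → a < suc m → b < suc m → v′ a ≡ v′ b → a ≡ b
    distinct′ a b a< b< e with position a a< | position b b<
    ... | old a<m  | old b<m  = distinct a b a<m b<m (trans (sym (v′-old a a<m)) (trans e (v′-old b b<m)))
    ... | old a<m  | new refl = ⊥-elim (old≢new a a<m (trans e v′-new))
    ... | new refl | old b<m  = ⊥-elim (old≢new b b<m (trans (sym e) v′-new))
    ... | new refl | new refl = refl

    v′-pred : ∀ {k} → suc k ≡ m → v′ k ≡ v (toℕ i)
    v′-pred {k} sk≡m = trans (v′-old k (subst (k <_) sk≡m (n<1+n k)))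
                             (cong v (suc-injective (trans sk≡m (sym exit-isLast))))

    adjacent′ : ∀ k → suc k < suc m → adj H (v′ k) (v′ (suc k)) ≡ true
    adjacent′ k sk< with position (suc k) sk<
    ... | old sk<m rewrite v′-old k (<-trans (n<1+n k) sk<m) | v′-old (suc k) sk<m = adjacent k sk<m
    ... | new sk≡m rewrite v′-pred sk≡m | sk≡m | v′-new = adj-w

    closed′ : ∀ k → suc k < suc m → ∀ y → adj H (v′ k) y ≡ true → ∃ λ j → j ≤ suc k × v′ j ≡ y
    closed′ k sk< y a with position (suc k) sk<
    ... | old sk<m with closed k sk<m y (subst (λ z → adj H z y ≡ true) (v′-old k (<-trans (n<1+n k) sk<m)) a)
    ...   | j , j≤ , vj≡y = j , j≤ , trans (v′-old j (≤-<-trans j≤ sk<m)) vj≡y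
    closed′ k sk< y a | new sk≡m with OnChain? y
    ...   | yes (j , vj≡y) = toℕ j , ≤-trans (<⇒≤ (toℕ<n j)) (≤-reflexive (sym sk≡m))
                           , trans (v′-old (toℕ j) (toℕ<n j)) vj≡y
    ...   | no y-off = m , ≤-reflexive (sym sk≡m)
                     , trans v′-new (sym (w-unique y (subst (λ z → adj H z y ≡ true) (v′-pred sk≡m) a) y-off))

    extended : Chain (suc m)
    extended = record
      { v = v′ ; distinct = distinct′ ; starts = trans (v′-old 0 1≤m) starts
      ; adjacent = adjacent′ ; closed = closed′ }

  chainOfLength : ∀ m → 1 ≤ m → m ≤ n → Chain m
  chainOfLength (suc zero)    _ _  = trivialChain
  chainOfLength (suc (suc m)) _ le =
    Extend.extended (chainOfLength (suc m) (s≤s z≤n) (<⇒≤ le)) (s≤s z≤n) le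

  -- A chain through all n vertices is an enumeration of H along a path: for i < j,
  -- v i ~ v j holds only for j = i + 1, since v i has no neighbours beyond v (i + 1).
  module Enumeration (1≤n : 1 ≤ n) where
    open Chain (chainOfLength n 1≤n ≤-refl)

    pathAdj : ℕ → ℕ → Bool
    pathAdj a b = (a ≡ᵇ suc b) ∨ (b ≡ᵇ suc a)

    adj-forward : ∀ a b → a < b → b < n → adj H (v a) (v b) ≡ (b ≡ᵇ suc a)
    adj-forward a b a<b b<n with b ℕ.≟ suc a
    ... | yes refl rewrite ≡ᵇ-refl (suc a) = adjacent a b<n
    ... | no b≢sa rewrite ≡ᵇ-false b≢sa with adj H (v a) (v b) in eq
    ...   | false = refl
    ...   | true with closed a (≤-<-trans a<b b<n) (v b) eq
    ...     | j , j≤ , vj≡vb with distinct j b (≤-<-trans j≤ (≤-<-trans a<b b<n)) b<n vj≡vb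
    ...       | refl = ⊥-elim (b≢sa (≤-antisym j≤ a<b))

    adj-chain : ∀ a b → a < n → b < n → adj H (v a) (v b) ≡ pathAdj a b
    adj-chain a b a<n b<n with <-cmp a b
    ... | tri< a<b _ _ rewrite ≡ᵇ-false (<⇒≢ (<-trans a<b (n<1+n b))) = adj-forward a b a<b b<n
    ... | tri≈ _ refl _ rewrite ≡ᵇ-false (<⇒≢ (n<1+n a)) = loopH (v a)
    ... | tri> _ _ b<a rewrite ≡ᵇ-false (<⇒≢ (<-trans b<a (n<1+n a))) | ∨-identityʳ (a ≡ᵇ suc b) =
          trans (symH (v a) (v b)) (adj-forward b a b<a a<n)

    enumerate : Fin n → Fin n
    enumerate a = v (toℕ a)

    enumerate-inj : ∀ {a b} → enumerate a ≡ enumerate b → a ≡ b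
    enumerate-inj {a} {b} e = toℕ-injective (distinct (toℕ a) (toℕ b) (toℕ<n a) (toℕ<n b) e)

    index : Fin n → Fin n
    index y = proj₁ (injective⇒surjective enumerate enumerate-inj y)

    enumerate-index : ∀ y → enumerate (index y) ≡ y
    enumerate-index y = proj₂ (injective⇒surjective enumerate enumerate-inj y)

    iso : H ≅ Path n
    iso = mk↔ₛ′ index enumerate (λ a → enumerate-inj (enumerate-index (enumerate a))) enumerate-index
        , λ a b → trans (sym (cong₂ (adj H) (enumerate-index a) (enumerate-index b)))
                        (adj-chain (toℕ (index a)) (toℕ (index b))
                                   (toℕ<n (index a)) (toℕ<n (index b)))

singletonZF⇒path : ∀ {n} (H : Graph n) → IsSimple H → (∃ λ t → IsZeroForcingSet H ⁅ t ⁆) → H ≅ Path n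
singletonZF⇒path {suc m} H (symH , loopH) (t , zf) = Enumeration.iso (s≤s z≤n)
  where open SingletonForcing H symH loopH t zf

-- The corona G ⊙ H

module Corona {N n : ℕ} (G : Graph N) (H : Graph n) where

  C : Graph (N + N * n)
  C = corona G H

  centre : Fin N → Fin (N + N * n)
  centre u = u ↑ˡ (N * n)

  leaf : Fin N → Fin n → Fin (N + N * n)
  leaf u h = N ↑ʳ combine u h

  split-centre : ∀ u → splitAt N (centre u) ≡ inj₁ u
  split-centre u = splitAt-↑ˡ N u (N * n)

  split-leaf : ∀ u h → splitAt N (leaf u h) ≡ inj₂ (combine u h)
  split-leaf u h = splitAt-↑ʳ N (N * n) (combine u h)

  quotRem-combine : ∀ u h → quotRem {N} n (combine u h) ≡ (h , u)
  quotRem-combine u h = cong swap (remQuot-combine {N} {n} u h)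

  data View : Fin (N + N * n) → Set where
    isCentre : ∀ u → View (centre u)
    isLeaf   : ∀ u h → View (leaf u h)

  view : ∀ p → View p
  view p with splitAt N p in eq
  ... | inj₁ u = subst View p≡ (isCentre u)
    where
    p≡ : centre u ≡ p
    p≡ = trans (cong (join N (N * n)) (sym eq)) (join-splitAt N (N * n) p)
  ... | inj₂ q = subst View p≡ (isLeaf (proj₁ (remQuot {N} n q)) (proj₂ (remQuot {N} n q)))
    where
    p≡ : leaf (proj₁ (remQuot {N} n q)) (proj₂ (remQuot {N} n q)) ≡ p
    p≡ = trans (cong (N ↑ʳ_) (combine-remQuot {N} n q))
               (trans (cong (join N (N * n)) (sym eq)) (join-splitAt N (N * n) p))

  centre-injective : ∀ {u v} → centre u ≡ centre v → u ≡ v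
  centre-injective {u} {v} = ↑ˡ-injective (N * n) u v

  leaf-injective : ∀ {u h v h′} → leaf u h ≡ leaf v h′ → u ≡ v × h ≡ h′
  leaf-injective {u} {h} {v} {h′} e = combine-injective u h v h′ (↑ʳ-injective N _ _ e)

  centre≢leaf : ∀ {u v h} → centre u ≢ leaf v h
  centre≢leaf {u} {v} {h} e with trans (sym (split-centre u)) (trans (cong (splitAt N) e) (split-leaf v h))
  ... | ()

  leaf≢leaf : ∀ {u h h′} → h ≢ h′ → leaf u h ≢ leaf u h′
  leaf≢leaf h≢h′ = h≢h′ ∘ proj₂ ∘ leaf-injective

  adj-centre-centre : ∀ u v → adj C (centre u) (centre v) ≡ adj G u v
  adj-centre-centre u v rewrite split-centre u | split-centre v = refl

  adj-centre-leaf : ∀ u v h → adj C (centre u) (leaf v h) ≡ ⌊ v ≟ u ⌋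
  adj-centre-leaf u v h rewrite split-centre u | split-leaf v h | quotRem-combine v h = refl

  adj-leaf-centre : ∀ u h v → adj C (leaf u h) (centre v) ≡ ⌊ u ≟ v ⌋
  adj-leaf-centre u h v rewrite split-centre v | split-leaf u h | quotRem-combine u h = refl

  adj-leaf-leaf : ∀ u h v h′ → adj C (leaf u h) (leaf v h′) ≡ ⌊ u ≟ v ⌋ ∧ adj H h h′
  adj-leaf-leaf u h v h′ rewrite split-leaf u h | split-leaf v h′
                               | quotRem-combine u h | quotRem-combine v h′ = refl

  centre-leaf-adjacent : ∀ u h → adj C (centre u) (leaf u h) ≡ true
  centre-leaf-adjacent u h = trans (adj-centre-leaf u u h) (≟-refl u)

  leaf-centre-adjacent : ∀ u h → adj C (leaf u h) (centre u) ≡ true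
  leaf-centre-adjacent u h = trans (adj-leaf-centre u h u) (≟-refl u)

  leaf-leaf-adjacent : ∀ u {h h′} → adj H h h′ ≡ true → adj C (leaf u h) (leaf u h′) ≡ true
  leaf-leaf-adjacent u {h} {h′} a = trans (adj-leaf-leaf u h u h′)
                                          (cong₂ _∧_ (≟-refl u) a)

  centre-leaf-sameCopy : ∀ {u v h} → adj C (centre u) (leaf v h) ≡ true → v ≡ u
  centre-leaf-sameCopy {u} {v} {h} a = ≟-true (trans (sym (adj-centre-leaf u v h)) a)

  leaf-centre-sameCopy : ∀ {u h v} → adj C (leaf u h) (centre v) ≡ true → u ≡ v
  leaf-centre-sameCopy {u} {h} {v} a = ≟-true (trans (sym (adj-leaf-centre u h v)) a)

  leaf-leaf-sameCopy : ∀ {u h v h′} → adj C (leaf u h) (leaf v h′) ≡ true → u ≡ v × adj H h h′ ≡ true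
  leaf-leaf-sameCopy {u} {h} {v} {h′} a with ∧-true (trans (sym (adj-leaf-leaf u h v h′)) a)
  ... | same , aH = ≟-true same , aH

  corona-noIsolated : Fin n → NoIsolatedVertex C
  corona-noIsolated h₀ p with view p
  ... | isCentre u = leaf u h₀ , leaf-centre-adjacent u h₀ , centre≢leaf ∘ sym
  ... | isLeaf u h = centre u , centre-leaf-adjacent u h , centre≢leaf

  ∣∣-corona : (T : Subset (N + N * n)) →
    ∣ T ∣ ≡ sum (λ u → indicator (lookup T (centre u)) + count (λ h → lookup T (leaf u h)))
  ∣∣-corona T = begin
    ∣ T ∣                                                        ≡⟨ ∣∣≡count T ⟩
    sum f                                                        ≡⟨ sum-↑ N (N * n) f ⟩
    sum (f ∘ centre) + sum (λ q → f (N ↑ʳ q))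
      ≡⟨ cong (sum (f ∘ centre) +_) (sum-combine N n (λ q → f (N ↑ʳ q))) ⟩
    sum (f ∘ centre) + sum (λ u → sum (λ h → f (leaf u h)))      ≡⟨ sym (∑-distrib-+ (f ∘ centre) _) ⟩
    sum (λ u → f (centre u) + count (λ h → lookup T (leaf u h))) ∎
    where
    open ≡-Reasoning
    f : Fin (N + N * n) → ℕ
    f = indicator ∘ lookup T

  -- (3) S ⊆ V(G) and B ⊆ V(H) zero forcing give a zero forcing set of G ⊙ H:
  -- S on the centres and B in every copy.  Forcing in G carries over, because each
  -- copy of H turns black as soon as its centre does.
  module Extension (S : Subset N) (B : Subset n)
                   (zfS : IsZeroForcingSet G S) (zfB : IsZeroForcingSet H B) where

    inT : Fin (N + N * n) → Bool
    inT p = [ lookup S , (λ q → lookup B (proj₁ (quotRem {N} n q))) ]′ (splitAt N p)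

    T : Subset (N + N * n)
    T = tabulate inT

    T-centre : ∀ u → lookup T (centre u) ≡ lookup S u
    T-centre u rewrite lookup∘tabulate inT (centre u) | split-centre u = refl

    T-leaf : ∀ u h → lookup T (leaf u h) ≡ lookup B h
    T-leaf u h rewrite lookup∘tabulate inT (leaf u h) | split-leaf u h | quotRem-combine u h = refl

    -- Once centre u is black, its copy is forced exactly as H is forced from B.
    blackCopy : ∀ {u h} → Black C T (centre u) → Black H B h → Black C T (leaf u h)
    blackCopy {u} {h} bu (initial h∈B) =
      initial (lookup⇒[]= (leaf u h) T (trans (T-leaf u h) (∈⇒lookup h∈B)))
    blackCopy {u} bu (force x w bx a others) =
      force (leaf u x) (leaf u w) (blackCopy bu bx) (leaf-leaf-adjacent u a) othersC
      where
      othersC : ∀ y → adj C (leaf u x) y ≡ true → y ≢ leaf u w → Black C T y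
      othersC y ay y≢ with view y
      ... | isCentre v with refl ← leaf-centre-sameCopy ay = bu
      ... | isLeaf v h′ with leaf-leaf-sameCopy ay
      ...   | refl , aH = blackCopy bu (others h′ aH (y≢ ∘ cong (leaf u)))

    -- A force x → w in G is a force in G ⊙ H: the leaves of x are black by blackCopy.
    blackCentre : ∀ {u} → Black G S u → Black C T (centre u)
    blackCentre {u} (initial u∈S) =
      initial (lookup⇒[]= (centre u) T (trans (T-centre u) (∈⇒lookup u∈S)))
    blackCentre (force x w bx a others) =
      force (centre x) (centre w) (blackCentre bx) (trans (adj-centre-centre x w) a) othersC
      where
      othersC : ∀ y → adj C (centre x) y ≡ true → y ≢ centre w → Black C T y
      othersC y ay y≢ with view y
      ... | isCentre v = blackCentre (others v (trans (sym (adj-centre-centre x v)) ay) (y≢ ∘ cong centre))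
      ... | isLeaf v h with refl ← centre-leaf-sameCopy ay = blackCopy (blackCentre bx) (zfB h)

    zfT : IsZeroForcingSet C T
    zfT p with view p
    ... | isCentre u = blackCentre (zfS u)
    ... | isLeaf u h = blackCopy (blackCentre (zfS u)) (zfB h)

    ∣T∣ : ∣ T ∣ ≡ ∣ S ∣ + N * ∣ B ∣
    ∣T∣ = begin
      ∣ T ∣
        ≡⟨ ∣∣-corona T ⟩
      sum (λ u → indicator (lookup T (centre u)) + count (λ h → lookup T (leaf u h)))
        ≡⟨ sum-cong (λ u → cong₂ _+_ (cong indicator (T-centre u)) (sum-cong (cong indicator ∘ T-leaf u))) ⟩
      sum (λ u → indicator (lookup S u) + count (lookup B))
        ≡⟨ ∑-distrib-+ (indicator ∘ lookup S) _ ⟩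
      count (lookup S) + sum {N} (λ _ → count (lookup B))
        ≡⟨ cong₂ _+_ (sym (∣∣≡count S)) (trans (sum-const N _) (cong (N *_) (sym (∣∣≡count B)))) ⟩
      ∣ S ∣ + N * ∣ B ∣
        ∎
      where open ≡-Reasoning

  module ForcingSet (noIso : NoIsolatedVertex H)
                    (T : Subset (N + N * n)) (zfT : IsZeroForcingSet C T) where

    inT-centre : Fin N → Bool
    inT-centre u = lookup T (centre u)

    inT-leaf : Fin N → Fin n → Bool
    inT-leaf u h = lookup T (leaf u h)

    -- Every copy of H meets T.  A leaf is forced either by a leaf of its own copy, or
    -- by its centre, which then already sees another black leaf of the copy.
    copyMeetsT : ∀ {u h} → Black C T (leaf u h) → 1 ≤ count (inT-leaf u)
    copyMeetsT {u} {h} (initial h∈T) = count≥1 (inT-leaf u) h (∈⇒lookup h∈T)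
    copyMeetsT {u} {h} (force x _ bx a others) with view x
    ... | isCentre v with refl ← centre-leaf-sameCopy a =
          copyMeetsT (others (leaf u h′) (centre-leaf-adjacent u h′) (leaf≢leaf h′≢h))
      where
      h′  = proj₁ (noIso h)
      h′≢h = proj₂ (proj₂ (noIso h))
    ... | isLeaf v h″ with refl ← proj₁ (leaf-leaf-sameCopy a) = copyMeetsT bx

    -- (1) T projects to the zero forcing set S of G of centres u that lie in T or
    -- whose copy contains two vertices of T; then |S| + N ≤ |T|.
    module Projection (symH : ∀ a b → adj H a b ≡ adj H b a) where

      inS : Fin N → Bool
      inS u = inT-centre u ∨ ⌊ 2 ≤? count (inT-leaf u) ⌋

      S : Subset N
      S = tabulate inS

      centre∈S : ∀ {u} → inT-centre u ≡ true → u ∈ S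
      centre∈S {u} e = ∈-tabulate inS (cong (_∨ ⌊ 2 ≤? count (inT-leaf u) ⌋) e)

      twoLeaves∈S : ∀ {u} → 2 ≤ count (inT-leaf u) → u ∈ S
      twoLeaves∈S {u} two =
        ∈-tabulate inS (trans (cong (inT-centre u ∨_) (⌊⌋-true (2 ≤? _) two)) (∨-zeroʳ (inT-centre u)))

      outNeighbour : ∀ h → ∃ λ h′ → adj H h h′ ≡ true × h′ ≢ h
      outNeighbour h with noIso h
      ... | h′ , a , h′≢h = h′ , trans (symH h h′) a , h′≢h

      -- A black leaf is in T or its centre is
      -- black in G from S: a leaf in T can force its centre only once a second leaf of
      -- the copy is black, so that leaf is in T too (and u ∈ S), or its centre is black.
      mutual
        centreBlack : ∀ {u} → Black C T (centre u) → Black G S u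
        centreBlack (initial u∈T) = initial (centre∈S (∈⇒lookup u∈T))
        centreBlack (force x _ bx a others) with view x
        ... | isCentre v = force v _ (centreBlack bx) (trans (sym (adj-centre-centre v _)) a)
                (λ y ay y≢ → centreBlack (others (centre y) (trans (adj-centre-centre v y) ay)
                                                             (y≢ ∘ centre-injective)))
        ... | isLeaf v h with refl ← leaf-centre-sameCopy a | leafBlack bx | outNeighbour h
        ...   | inj₂ b   | _ = b
        ...   | inj₁ h∈T | h′ , h~h′ , h′≢h
                with leafBlack (others (leaf v h′) (leaf-leaf-adjacent v h~h′) (centre≢leaf ∘ sym))
        ...     | inj₂ b     = b
        ...     | inj₁ h′∈T = initial (twoLeaves∈S (count≥2 (inT-leaf v) h h′ (h′≢h ∘ sym) h∈T h′∈T))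

        leafBlack : ∀ {u h} → Black C T (leaf u h) → inT-leaf u h ≡ true ⊎ Black G S u
        leafBlack (initial h∈T) = inj₁ (∈⇒lookup h∈T)
        leafBlack (force x _ bx a others) with view x
        ... | isCentre v with refl ← centre-leaf-sameCopy a = inj₂ (centreBlack bx)
        ... | isLeaf v h″ with refl ← proj₁ (leaf-leaf-sameCopy a) | leafBlack bx
        ...   | inj₂ b = inj₂ b
        ...   | inj₁ _ = inj₂ (centreBlack (others (centre v) (leaf-centre-adjacent v h″) centre≢leaf))

      zfS : IsZeroForcingSet G S
      zfS u = centreBlack (zfT (centre u))

      -- each copy contributes a vertex of T, plus a second one when u ∈ S ∖ T
      ∣S∣+N≤∣T∣ : Fin n → ∣ S ∣ + N ≤ ∣ T ∣
      ∣S∣+N≤∣T∣ h₀ = begin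
        ∣ S ∣ + N
          ≡⟨ cong₂ _+_ ∣S∣≡ (sym (trans (sum-const N 1) (*-identityʳ N))) ⟩
        sum (indicator ∘ inS) + sum {N} (λ _ → 1)
          ≡⟨ sym (∑-distrib-+ (indicator ∘ inS) _) ⟩
        sum (λ u → indicator (inS u) + 1)
          ≤⟨ sum-mono pointwise ⟩
        sum (λ u → indicator (inT-centre u) + count (inT-leaf u))
          ≡⟨ sym (∣∣-corona T) ⟩
        ∣ T ∣
          ∎
        where
        open Data.Nat.Properties.≤-Reasoning
        ∣S∣≡ : ∣ S ∣ ≡ sum (indicator ∘ inS)
        ∣S∣≡ = trans (∣∣≡count S) (sum-cong (cong indicator ∘ lookup∘tabulate inS))
        pointwise : ∀ u → indicator (inS u) + 1 ≤ indicator (inT-centre u) + count (inT-leaf u)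
        pointwise u with inT-centre u | copyMeetsT (zfT (leaf u h₀))
        ... | true  | meets = s≤s meets
        ... | false | meets with 2 ≤? count (inT-leaf u)
        ...   | yes two = two
        ...   | no _    = meets

    -- (2) If |T| < 2N, the copy at some centre u₀ contains a single vertex t of T.
    -- Leaves of that copy are forced only by their centre or by leaves of the same
    -- copy, and either way this is a forcing step of H from {t}.
    module Sparse (h₀ : Fin n) (small : ∣ T ∣ < N + N) where

      sparseCopy : ∃ λ u → ¬ (2 ≤ indicator (inT-centre u) + count (inT-leaf u))
      sparseCopy = ¬∀⟶∃¬ N _ (λ u → 2 ≤? indicator (inT-centre u) + count (inT-leaf u)) notAllDense
        where
        notAllDense : ¬ (∀ u → 2 ≤ indicator (inT-centre u) + count (inT-leaf u))
        notAllDense dense = <⇒≱ small (subst₂ _≤_ 2N (sym (∣∣-corona T)) (sum-mono dense))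
          where
          2N : sum {N} (λ _ → 2) ≡ N + N
          2N = trans (sum-const N 2) (trans (*-comm N 2) (cong (N +_) (+-identityʳ N)))

      u₀ : Fin N
      u₀ = proj₁ sparseCopy

      vertexInT : ∃ λ t → inT-leaf u₀ t ≡ true
      vertexInT = count≥1⇒witness (inT-leaf u₀) (copyMeetsT (zfT (leaf u₀ h₀)))

      t : Fin n
      t = proj₁ vertexInT

      t∈T : inT-leaf u₀ t ≡ true
      t∈T = proj₂ vertexInT

      t-unique : ∀ h → inT-leaf u₀ h ≡ true → h ≡ t
      t-unique h h∈T with h ≟ t
      ... | yes h≡t = h≡t
      ... | no h≢t  = ⊥-elim (proj₂ sparseCopy
                        (≤-trans (count≥2 (inT-leaf u₀) h t h≢t h∈T t∈T) (m≤n+m _ (indicator (inT-centre u₀)))))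

      blackInCopy : ∀ {h} → Black C T (leaf u₀ h) → Black H ⁅ t ⁆ h
      blackInCopy {h} (initial h∈T) =
        subst (Black H ⁅ t ⁆) (sym (t-unique h (∈⇒lookup h∈T))) (initial (x∈⁅x⁆ t))
      blackInCopy {h} (force x _ bx a others) with view x
      ... | isCentre v with refl ← centre-leaf-sameCopy a =
            -- the centre sees the whole copy black except h, in particular a neighbour h′ of h
            force h′ h (inCopy h′ h′≢h) h′~h (λ y _ → inCopy y)
        where
        h′   = proj₁ (noIso h)
        h′~h = proj₁ (proj₂ (noIso h))
        h′≢h = proj₂ (proj₂ (noIso h))
        inCopy : ∀ y → y ≢ h → Black H ⁅ t ⁆ y
        inCopy y y≢h = blackInCopy (others (leaf u₀ y) (centre-leaf-adjacent u₀ y) (leaf≢leaf y≢h))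
      ... | isLeaf v h″ with leaf-leaf-sameCopy a
      ...   | refl , aH = force h″ h (blackInCopy bx) aH
              (λ y ay y≢h → blackInCopy (others (leaf u₀ y) (leaf-leaf-adjacent u₀ ay) (leaf≢leaf y≢h)))

      zfH : IsZeroForcingSet H ⁅ t ⁆
      zfH h = blackInCopy (zfT (leaf u₀ h))

iterOrder≡ : ∀ n1 n2 k → iterOrder n1 n2 k ≡ n1 * suc n2 ^ k
iterOrder≡ n1 n2 zero    = sym (*-identityʳ n1)
iterOrder≡ n1 n2 (suc k) = begin
  iterOrder n1 n2 k + iterOrder n1 n2 k * n2 ≡⟨ sym (*-suc (iterOrder n1 n2 k) n2) ⟩
  iterOrder n1 n2 k * suc n2                 ≡⟨ cong (_* suc n2) (iterOrder≡ n1 n2 k) ⟩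
  n1 * suc n2 ^ k * suc n2                   ≡⟨ *-assoc n1 (suc n2 ^ k) (suc n2) ⟩
  n1 * (suc n2 ^ k * suc n2)                 ≡⟨ cong (n1 *_) (*-comm (suc n2 ^ k) (suc n2)) ⟩
  n1 * suc n2 ^ suc k                        ∎
  where open ≡-Reasoning

iterCorona-vertex : ∀ {n1} n2 → Fin n1 → ∀ k → Fin (iterOrder n1 n2 k)
iterCorona-vertex n2 v zero    = v
iterCorona-vertex n2 v (suc k) = iterCorona-vertex n2 v k ↑ˡ _

iterCorona-noIsolated : ∀ {n1 n2} (G : Graph n1) (H : Graph n2) → 2 ≤ n1 → Connected G →
                        Fin n2 → ∀ k → NoIsolatedVertex (iterCorona G H k)
iterCorona-noIsolated G H 2≤n1 connG h₀ zero    = connected⇒noIsolated G 2≤n1 connG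
iterCorona-noIsolated G H 2≤n1 connG h₀ (suc k) = Corona.corona-noIsolated (iterCorona G H k) H h₀

-- The theorem (k = j + 1)

mainTheorem11 : ∀ {n1 n2 : ℕ} (G : Graph n1) (H : Graph n2) →
    2 ≤ n1 → 2 ≤ n2 → IsSimple G → IsSimple H → Connected G → Connected H →
    ∀ (j zk zk1 : ℕ) →
    IsZeroForcingNumber (iterCorona G H (suc j)) zk →
    IsZeroForcingNumber (iterCorona G H j) zk1 →
    ((zk ≡ zk1 + n1 * (suc n2) ^ j) ⇔ (H ≅ Path n2))
mainTheorem11 {n1} {n2} G H 2≤n1 2≤n2 _ simpleH connG connH j zk zk1
              ((T , zfT , ∣T∣≡zk) , zk-minimal) Zk1@((S₁ , zfS₁ , ∣S₁∣≡zk1) , zk1-minimal) =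
  mk⇔ ⇒ ⇐
  where
  G′ = iterCorona G H j
  N  = iterOrder n1 n2 j

  N≡ : N ≡ n1 * suc n2 ^ j
  N≡ = iterOrder≡ n1 n2 j

  h₀ : Fin n2
  h₀ = fromℕ< (≤-trans (s≤s z≤n) 2≤n2)

  open Corona G′ H using (module ForcingSet; module Extension)
  open ForcingSet (connected⇒noIsolated H 2≤n2 connH) T zfT

  lower : zk1 + N ≤ zk
  lower = subst (zk1 + N ≤_) ∣T∣≡zk (≤-trans (+-monoˡ-≤ N (zk1-minimal S zfS)) (∣S∣+N≤∣T∣ h₀))
    where open Projection (proj₁ simpleH)

  -- Z(G′) < N, since G′ has no isolated vertex
  zk1<N : zk1 < N
  zk1<N = noIsolated⇒Z<order G′ (iterCorona-noIsolated G H 2≤n1 connG h₀ j)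
                             (iterCorona-vertex n2 (fromℕ< (≤-trans (s≤s z≤n) 2≤n1)) j) zk1 Zk1

  -- equality makes |T| = Z(G′) + N < 2N: then (2) gives H a one-vertex forcing set and (4) applies
  ⇒ : zk ≡ zk1 + n1 * suc n2 ^ j → H ≅ Path n2
  ⇒ zk≡ = singletonZF⇒path H simpleH (t , zfH)
    where
    ∣T∣≡ : ∣ T ∣ ≡ zk1 + N
    ∣T∣≡ = trans ∣T∣≡zk (trans zk≡ (cong (zk1 +_) (sym N≡)))
    open Sparse h₀ (subst (_< N + N) (sym ∣T∣≡) (+-monoˡ-< N zk1<N))

  -- by (5) and (3), Z(G′ ⊙ H) ≤ Z(G′) + N · 1, and (1) gives the reverse inequality
  ⇐ : H ≅ Path n2 → zk ≡ zk1 + n1 * suc n2 ^ j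
  ⇐ H≅P = trans (≤-antisym upper lower) (cong (zk1 +_) N≡)
    where
    tH = ≅path⇒singletonZF H (≤-trans (s≤s z≤n) 2≤n2) H≅P
    module E = Extension S₁ ⁅ proj₁ tH ⁆ zfS₁ (proj₂ tH)
    ∣E∣≡ : ∣ E.T ∣ ≡ zk1 + N
    ∣E∣≡ = trans E.∣T∣ (cong₂ _+_ ∣S₁∣≡zk1 (trans (cong (N *_) (∣⁅x⁆∣≡1 (proj₁ tH))) (*-identityʳ N)))
    upper : zk ≤ zk1 + N
    upper = subst (zk ≤_) ∣E∣≡ (zk-minimal E.T E.zfT)
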